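{- Let $A$ and $B$ be two variable-disjoint first-order atoms, each containing at most one variable (possibly with multiple occurrences). If $A$ and $B$ are unifiable and $\theta$ is a most general unifier of $A$ and $B$, then $A\theta\simeq A$, or $B\theta\simeq B$, or $A\theta=B\theta$ is ground.
   Context: Atoms $A,B$ are variable disjoint if they share no variables. $A$ is more general than $B$, written $A\lesssim B$, if there is a substitution $\theta$ with $A\theta=B$; $A\simeq B$ means $A\lesssim B$ and $B\lesssim A$. A unifier of $A$ and $B$ is a substitution $\theta$ with $A\theta=B\theta$; it is most general if $A\theta\lesssim A\theta'$ for every unifier $\theta'$ of $A$ and $B$. -}

module Defs where

open import Data.Nat using (ℕ)
open import Data.Vec using (Vec; []; _∷_)
open import Data.Product using (Σ; _×_)
open import Data.Sum using (_⊎_)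
open import Data.Empty using (⊥)
open import Relation.Nullary using (¬_)
open import Relation.Binary.PropositionalEquality using (_≡_)

record Signature : Set₁ where
  field
    Fun   : Set
    arity : Fun → ℕ
    Pred  : Set
    parity : Pred → ℕ

module FO (Σ' : Signature) where
  open Signature Σ'

  Var : Set
  Var = ℕ

  data Term : Set where
    var : Var → Term
    fun : (f : Fun) → Vec Term (arity f) → Term

  data Atom : Set where
    atom : (p : Pred) → Vec Term (parity p) → Atom

  Subst : Set
  Subst = Var → Term

  mutual
    _·_ : Term → Subst → Term
    var x · θ = θ x
    fun f ts · θ = fun f (ts ·ᵛ θ)

    _·ᵛ_ : ∀ {n} → Vec Term n → Subst → Vec Term n
    [] ·ᵛ θ = []
    (t ∷ ts) ·ᵛ θ = (t · θ) ∷ (ts ·ᵛ θ)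

  _∙_ : Atom → Subst → Atom
  atom p ts ∙ θ = atom p (ts ·ᵛ θ)

  mutual
    data _occursIn_ (x : Var) : Term → Set where
      here : x occursIn var x
      inside : ∀ {f ts} → x occursInᵛ ts → x occursIn fun f ts

    data _occursInᵛ_ (x : Var) : ∀ {n} → Vec Term n → Set where
      head : ∀ {n t} {ts : Vec Term n} → x occursIn t → x occursInᵛ (t ∷ ts)
      tail : ∀ {n t} {ts : Vec Term n} → x occursInᵛ ts → x occursInᵛ (t ∷ ts)

  data _occursInAtom_ (x : Var) : Atom → Set where
    inAtom : ∀ {p ts} → x occursInᵛ ts → x occursInAtom atom p ts

  VariableDisjoint : Atom → Atom → Set
  VariableDisjoint A B = ∀ x → x occursInAtom A → x occursInAtom B → ⊥

  AtMostOneVar : Atom → Set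
  AtMostOneVar A = ∀ x y → x occursInAtom A → y occursInAtom A → x ≡ y

  Ground : Atom → Set
  Ground A = ∀ x → ¬ (x occursInAtom A)

  _≲_ : Atom → Atom → Set
  A ≲ B = Σ Subst (λ θ → A ∙ θ ≡ B)

  _≃_ : Atom → Atom → Set
  A ≃ B = (A ≲ B) × (B ≲ A)

  IsUnifier : Atom → Atom → Subst → Set
  IsUnifier A B θ = A ∙ θ ≡ B ∙ θ

  Unifiable : Atom → Atom → Set
  Unifiable A B = Σ Subst (IsUnifier A B)

  IsMGU : Atom → Atom → Subst → Set
  IsMGU A B θ = IsUnifier A B θ × (∀ θ' → IsUnifier A B θ' → (A ∙ θ) ≲ (A ∙ θ'))

-- Say A has the single variable x, B the single variable y, and Aθ = Bθ is not
-- ground.  Walking down A and B to a position where Aθ has a variable, one finds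
-- a variable of one atom facing a subterm of the other, say θx = bθ with b a term
-- over y.  Since θy is not ground, θ cannot identify distinct terms over y (the
-- occurs check), so A[x ↦ b] = B, i.e. [x ↦ b] is a unifier fixing B.  As θ is most
-- general, Bθ = Aθ ≲ A[x ↦ b] = B, and B ≲ Bθ holds trivially.
module Submission where

open import Defs
open import Data.Product using (_×_)
open import Data.Sum using (_⊎_)
open import Relation.Binary.PropositionalEquality using (_≡_)

open import Data.Nat using (ℕ; suc; _+_; _≤_; s≤s)
open import Data.Nat.Properties using (≤-refl; ≤-trans; m≤m+n; m≤n+m; m≤n⇒m≤1+n; <-irrefl; _≟_)
open import Data.Vec using (Vec; []; _∷_)
open import Data.Vec.Properties using (∷-injectiveˡ; ∷-injectiveʳ)
open import Data.Product using (∃; _,_)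
open import Data.Sum using (inj₁; inj₂; map₂)
open import Data.Empty using (⊥-elim)
open import Relation.Nullary using (¬_; yes; no)
open import Relation.Binary.PropositionalEquality
  using (_≢_; refl; sym; trans; cong; cong₂; subst; subst₂)

module Substitution (S : Signature) where
  open Signature S
  open FO S

  _⨾_ : Subst → Subst → Subst
  (σ ⨾ ρ) w = σ w · ρ

  OnlyVar : Var → Term → Set
  OnlyVar y t = ∀ w → w occursIn t → w ≡ y

  OnlyVarᵛ : ∀ {n} → Var → Vec Term n → Set
  OnlyVarᵛ y ts = ∀ w → w occursInᵛ ts → w ≡ y

  OnlyVarAtom : Var → Atom → Set
  OnlyVarAtom y A = ∀ w → w occursInAtom A → w ≡ y

  fun-injectiveˡ : ∀ {f g} {us : Vec Term (arity f)} {vs : Vec Term (arity g)} →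
                   fun f us ≡ fun g vs → f ≡ g
  fun-injectiveˡ refl = refl

  fun-injectiveʳ : ∀ {f} {us vs : Vec Term (arity f)} → fun f us ≡ fun f vs → us ≡ vs
  fun-injectiveʳ refl = refl

  atom-injectiveˡ : ∀ {p q} {us : Vec Term (parity p)} {vs : Vec Term (parity q)} →
                    atom p us ≡ atom q vs → p ≡ q
  atom-injectiveˡ refl = refl

  atom-injectiveʳ : ∀ {p} {us vs : Vec Term (parity p)} → atom p us ≡ atom p vs → us ≡ vs
  atom-injectiveʳ refl = refl

  mutual
    ·-agree : ∀ t {σ ρ} → (∀ w → w occursIn t → σ w ≡ ρ w) → t · σ ≡ t · ρ
    ·-agree (var x) h = h x here
    ·-agree (fun f ts) h = cong (fun f) (·ᵛ-agree ts (λ w o → h w (inside o)))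

    ·ᵛ-agree : ∀ {n} (ts : Vec Term n) {σ ρ} →
               (∀ w → w occursInᵛ ts → σ w ≡ ρ w) → ts ·ᵛ σ ≡ ts ·ᵛ ρ
    ·ᵛ-agree [] h = refl
    ·ᵛ-agree (t ∷ ts) h =
      cong₂ _∷_ (·-agree t (λ w o → h w (head o))) (·ᵛ-agree ts (λ w o → h w (tail o)))

  mutual
    ·-identity : ∀ t → t · var ≡ t
    ·-identity (var x) = refl
    ·-identity (fun f ts) = cong (fun f) (·ᵛ-identity ts)

    ·ᵛ-identity : ∀ {n} (ts : Vec Term n) → ts ·ᵛ var ≡ ts
    ·ᵛ-identity [] = refl
    ·ᵛ-identity (t ∷ ts) = cong₂ _∷_ (·-identity t) (·ᵛ-identity ts)

  mutual
    ·-⨾ : ∀ t σ ρ → (t · σ) · ρ ≡ t · (σ ⨾ ρ)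
    ·-⨾ (var x) σ ρ = refl
    ·-⨾ (fun f ts) σ ρ = cong (fun f) (·ᵛ-⨾ ts σ ρ)

    ·ᵛ-⨾ : ∀ {n} (ts : Vec Term n) σ ρ → (ts ·ᵛ σ) ·ᵛ ρ ≡ ts ·ᵛ (σ ⨾ ρ)
    ·ᵛ-⨾ [] σ ρ = refl
    ·ᵛ-⨾ (t ∷ ts) σ ρ = cong₂ _∷_ (·-⨾ t σ ρ) (·ᵛ-⨾ ts σ ρ)

  mutual
    occursIn-· : ∀ t σ {z} → z occursIn (t · σ) → ∃ λ w → w occursIn t × z occursIn σ w
    occursIn-· (var x) σ z∈ = x , here , z∈
    occursIn-· (fun f ts) σ (inside z∈) with occursInᵛ-·ᵛ ts σ z∈
    ... | w , w∈ , z∈σw = w , inside w∈ , z∈σw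

    occursInᵛ-·ᵛ : ∀ {n} (ts : Vec Term n) σ {z} →
                 z occursInᵛ (ts ·ᵛ σ) → ∃ λ w → w occursInᵛ ts × z occursIn σ w
    occursInᵛ-·ᵛ (t ∷ ts) σ (head z∈) with occursIn-· t σ z∈
    ... | w , w∈ , z∈σw = w , head w∈ , z∈σw
    occursInᵛ-·ᵛ (t ∷ ts) σ (tail z∈) with occursInᵛ-·ᵛ ts σ z∈
    ... | w , w∈ , z∈σw = w , tail w∈ , z∈σw

  mutual
    var-or-ground : ∀ t → (∃ λ x → x occursIn t) ⊎ (∀ x → ¬ x occursIn t)
    var-or-ground (var x) = inj₁ (x , here)
    var-or-ground (fun f ts) with var-or-groundᵛ ts
    ... | inj₁ (x , x∈) = inj₁ (x , inside x∈)
    ... | inj₂ ground = inj₂ λ { x (inside x∈) → ground x x∈ }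

    var-or-groundᵛ : ∀ {n} (ts : Vec Term n) →
                     (∃ λ x → x occursInᵛ ts) ⊎ (∀ x → ¬ x occursInᵛ ts)
    var-or-groundᵛ [] = inj₂ λ x ()
    var-or-groundᵛ (t ∷ ts) with var-or-ground t | var-or-groundᵛ ts
    ... | inj₁ (x , x∈) | _ = inj₁ (x , head x∈)
    ... | inj₂ _ | inj₁ (x , x∈) = inj₁ (x , tail x∈)
    ... | inj₂ ground | inj₂ groundᵛ =
      inj₂ λ { x (head x∈) → ground x x∈ ; x (tail x∈) → groundᵛ x x∈ }

  mutual
    size : Term → ℕ
    size (var _) = 1
    size (fun f ts) = suc (sizeᵛ ts)

    sizeᵛ : ∀ {n} → Vec Term n → ℕ
    sizeᵛ [] = 0
    sizeᵛ (t ∷ ts) = size t + sizeᵛ ts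

  mutual
    size-occurs : ∀ t σ {w} → w occursIn t → size (σ w) ≤ size (t · σ)
    size-occurs (var x) σ here = ≤-refl
    size-occurs (fun f ts) σ (inside w∈) = m≤n⇒m≤1+n (size-occursᵛ ts σ w∈)

    size-occursᵛ : ∀ {n} (ts : Vec Term n) σ {w} → w occursInᵛ ts → size (σ w) ≤ sizeᵛ (ts ·ᵛ σ)
    size-occursᵛ (t ∷ ts) σ (head w∈) = ≤-trans (size-occurs t σ w∈) (m≤m+n _ _)
    size-occursᵛ (t ∷ ts) σ (tail w∈) = ≤-trans (size-occursᵛ ts σ w∈) (m≤n+m _ _)

  occurs-check : ∀ {f ts} σ {w} → w occursInᵛ ts → σ w ≢ fun f ts · σ
  occurs-check {ts = ts} σ w∈ts eq = <-irrefl (cong size eq) (s≤s (size-occursᵛ ts σ w∈ts))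

  module _ {θ : Subst} {y z : Var} (z∈θy : z occursIn θ y) where

    θy-not-proper-instance : ∀ {g vs} → OnlyVar y (fun g vs) → θ y ≢ fun g vs · θ
    θy-not-proper-instance {vs = vs} only eq
      with occursIn-· (fun _ vs) θ (subst (z occursIn_) eq z∈θy)
    ... | w , inside w∈vs , _ with only w (inside w∈vs)
    ... | refl = occurs-check θ w∈vs eq

    mutual
      ·-injective : ∀ u v → OnlyVar y u → OnlyVar y v → u · θ ≡ v · θ → u ≡ v
      ·-injective (var a) (var b) ou ov eq with ou a here | ov b here
      ... | refl | refl = refl
      ·-injective (var a) (fun g vs) ou ov eq with ou a here
      ... | refl = ⊥-elim (θy-not-proper-instance ov eq)
      ·-injective (fun f us) (var b) ou ov eq with ov b here
      ... | refl = ⊥-elim (θy-not-proper-instance ou (sym eq))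
      ·-injective (fun f us) (fun g vs) ou ov eq with fun-injectiveˡ eq
      ... | refl = cong (fun f) (·ᵛ-injective us vs (λ w o → ou w (inside o))
                                                    (λ w o → ov w (inside o)) (fun-injectiveʳ eq))

      ·ᵛ-injective : ∀ {n} (us vs : Vec Term n) → OnlyVarᵛ y us → OnlyVarᵛ y vs →
                     us ·ᵛ θ ≡ vs ·ᵛ θ → us ≡ vs
      ·ᵛ-injective [] [] ou ov eq = refl
      ·ᵛ-injective (u ∷ us) (v ∷ vs) ou ov eq =
        cong₂ _∷_ (·-injective u v (λ w o → ou w (head o)) (λ w o → ov w (head o)) (∷-injectiveˡ eq))
                  (·ᵛ-injective us vs (λ w o → ou w (tail o)) (λ w o → ov w (tail o)) (∷-injectiveʳ eq))

  BoundOver : Subst → Var → Var → Set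
  BoundOver θ x y = ∃ λ b → OnlyVar y b × θ x ≡ b · θ

  module _ {θ : Subst} {x y z : Var} where
    -- The occurrence of z only selects the path along which the walk descends.
    mutual
      disagreement : ∀ a b → OnlyVar x a → OnlyVar y b → z occursIn (a · θ) → a · θ ≡ b · θ →
                     BoundOver θ x y ⊎ BoundOver θ y x
      disagreement (var w) b oa ob _ eq with oa w here
      ... | refl = inj₁ (b , ob , eq)
      disagreement (fun f as) (var w) oa ob _ eq with ob w here
      ... | refl = inj₂ (fun f as , oa , sym eq)
      disagreement (fun f as) (fun g bs) oa ob (inside z∈) eq with fun-injectiveˡ eq
      ... | refl = disagreementᵛ as bs (λ w o → oa w (inside o)) (λ w o → ob w (inside o))
                                 z∈ (fun-injectiveʳ eq)

      disagreementᵛ : ∀ {n} (as bs : Vec Term n) → OnlyVarᵛ x as → OnlyVarᵛ y bs →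
                      z occursInᵛ (as ·ᵛ θ) → as ·ᵛ θ ≡ bs ·ᵛ θ → BoundOver θ x y ⊎ BoundOver θ y x
      disagreementᵛ (a ∷ as) (b ∷ bs) oa ob (head z∈) eq =
        disagreement a b (λ w o → oa w (head o)) (λ w o → ob w (head o)) z∈ (∷-injectiveˡ eq)
      disagreementᵛ (a ∷ as) (b ∷ bs) oa ob (tail z∈) eq =
        disagreementᵛ as bs (λ w o → oa w (tail o)) (λ w o → ob w (tail o)) z∈ (∷-injectiveʳ eq)

  ∙-agree : ∀ A {σ ρ} → (∀ w → w occursInAtom A → σ w ≡ ρ w) → A ∙ σ ≡ A ∙ ρ
  ∙-agree (atom p ts) h = cong (atom p) (·ᵛ-agree ts (λ w o → h w (inAtom o)))

  ∙-identity : ∀ A → A ∙ var ≡ A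
  ∙-identity (atom p ts) = cong (atom p) (·ᵛ-identity ts)

  ∙-fixed : ∀ A {σ} → (∀ w → w occursInAtom A → σ w ≡ var w) → A ∙ σ ≡ A
  ∙-fixed A h = trans (∙-agree A h) (∙-identity A)

  ∙-⨾ : ∀ A σ ρ → (A ∙ σ) ∙ ρ ≡ A ∙ (σ ⨾ ρ)
  ∙-⨾ (atom p ts) σ ρ = cong (atom p) (·ᵛ-⨾ ts σ ρ)

  occursInAtom-∙ : ∀ A σ {z} → z occursInAtom (A ∙ σ) → ∃ λ w → w occursInAtom A × z occursIn σ w
  occursInAtom-∙ (atom p ts) σ (inAtom z∈) with occursInᵛ-·ᵛ ts σ z∈
  ... | w , w∈ , z∈σw = w , inAtom w∈ , z∈σw

  var-or-groundAtom : ∀ A → (∃ λ x → x occursInAtom A) ⊎ Ground A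
  var-or-groundAtom (atom p ts) with var-or-groundᵛ ts
  ... | inj₁ (x , x∈) = inj₁ (x , inAtom x∈)
  ... | inj₂ ground = inj₂ λ { x (inAtom x∈) → ground x x∈ }

  ∙-injective : ∀ {θ y z} → z occursIn θ y → ∀ {A B} → OnlyVarAtom y A → OnlyVarAtom y B →
                A ∙ θ ≡ B ∙ θ → A ≡ B
  ∙-injective z∈θy {atom p us} {atom q vs} oA oB eq with atom-injectiveˡ eq
  ... | refl = cong (atom p) (·ᵛ-injective z∈θy us vs (λ w o → oA w (inAtom o))
                                                       (λ w o → oB w (inAtom o)) (atom-injectiveʳ eq))

  disagreementAtom : ∀ {θ x y z A B} → OnlyVarAtom x A → OnlyVarAtom y B →
                     z occursInAtom (A ∙ θ) → IsUnifier A B θ → BoundOver θ x y ⊎ BoundOver θ y x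
  disagreementAtom {A = atom p as} {atom q bs} oA oB (inAtom z∈) eq with atom-injectiveˡ eq
  ... | refl = disagreementᵛ as bs (λ w o → oA w (inAtom o)) (λ w o → oB w (inAtom o))
                             z∈ (atom-injectiveʳ eq)

  ground⇒∙≃ : ∀ {A} θ → Ground A → (A ∙ θ) ≃ A
  ground⇒∙≃ {A} θ ground = (var , trans (∙-identity (A ∙ θ)) Aθ≡A) , (θ , refl)
    where
      Aθ≡A : A ∙ θ ≡ A
      Aθ≡A = ∙-fixed A (λ w w∈A → ⊥-elim (ground w w∈A))

  IsMGU-sym : ∀ {A B θ} → IsMGU A B θ → IsMGU B A θ
  IsMGU-sym (unifies , most-general) =
    sym unifies , λ θ′ unifies′ → subst₂ _≲_ unifies (sym unifies′) (most-general θ′ (sym unifies′))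

  _↦_ : Var → Term → Subst
  (x ↦ u) w with w ≟ x
  ... | yes _ = u
  ... | no _ = var w

  ↦-same : ∀ x u → (x ↦ u) x ≡ u
  ↦-same x u with x ≟ x
  ... | yes _ = refl
  ... | no x≢x = ⊥-elim (x≢x refl)

  ↦-other : ∀ {x w} u → w ≢ x → (x ↦ u) w ≡ var w
  ↦-other {x} {w} u w≢x with w ≟ x
  ... | yes w≡x = ⊥-elim (w≢x w≡x)
  ... | no _ = refl

  ∙-↦-fresh : ∀ {x B} u → ¬ x occursInAtom B → B ∙ (x ↦ u) ≡ B
  ∙-↦-fresh {B = B} u x∉B =
    ∙-fixed B (λ w w∈B → ↦-other u (λ { refl → x∉B w∈B }))

  ∙-↦-OnlyVar : ∀ {x y u A} → OnlyVarAtom x A → OnlyVar y u → OnlyVarAtom y (A ∙ (x ↦ u))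
  ∙-↦-OnlyVar {x} {u = u} {A} oA ou w w∈ with occursInAtom-∙ A (x ↦ u) w∈
  ... | v , v∈A , w∈ with oA v v∈A
  ... | refl = ou w (subst (w occursIn_) (↦-same v u) w∈)

  ∙-↦-absorb : ∀ {θ x u} A → θ x ≡ u · θ → (A ∙ (x ↦ u)) ∙ θ ≡ A ∙ θ
  ∙-↦-absorb {θ} {x} {u} A θx≡uθ = trans (∙-⨾ A (x ↦ u) θ) (∙-agree A (λ w _ → ↦⨾θ w))
    where
      ↦⨾θ : ∀ w → ((x ↦ u) ⨾ θ) w ≡ θ w
      ↦⨾θ w with w ≟ x
      ... | yes refl = sym θx≡uθ
      ... | no _ = refl

  bound⇒∙≃ : ∀ {A B θ x y z} → OnlyVarAtom x A → OnlyVarAtom y B → ¬ x occursInAtom B →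
             IsMGU A B θ → BoundOver θ x y → z occursInAtom (B ∙ θ) → (B ∙ θ) ≃ B
  bound⇒∙≃ {A} {B} {θ} {x} {y} {z} oA oB x∉B (unifies , most-general) (b , ob , θx≡bθ) z∈Bθ =
    subst₂ _≲_ unifies A[x↦b]≡B (most-general (x ↦ b) unifier) , (θ , refl)
    where
      z∈θy : z occursIn θ y
      z∈θy with occursInAtom-∙ B θ z∈Bθ
      ... | w , w∈B , z∈θw = subst (λ v → z occursIn θ v) (oB w w∈B) z∈θw

      A[x↦b]≡B : A ∙ (x ↦ b) ≡ B
      A[x↦b]≡B = ∙-injective z∈θy (∙-↦-OnlyVar oA ob) oB (trans (∙-↦-absorb A θx≡bθ) unifies)

      unifier : IsUnifier A B (x ↦ b)
      unifier = trans A[x↦b]≡B (sym (∙-↦-fresh b x∉B))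

  mgu-one-variable-≃ : ∀ {A B θ x y z} → OnlyVarAtom x A → OnlyVarAtom y B → x ≢ y →
                       IsMGU A B θ → z occursInAtom (A ∙ θ) → ((A ∙ θ) ≃ A) ⊎ ((B ∙ θ) ≃ B)
  mgu-one-variable-≃ {z = z} oA oB x≢y mgu@(unifies , _) z∈Aθ
    with disagreementAtom oA oB z∈Aθ unifies
  ... | inj₁ x-bound =
    inj₂ (bound⇒∙≃ oA oB (λ x∈B → x≢y (oB _ x∈B)) mgu x-bound (subst (z occursInAtom_) unifies z∈Aθ))
  ... | inj₂ y-bound =
    inj₁ (bound⇒∙≃ oB oA (λ y∈A → x≢y (sym (oA _ y∈A))) (IsMGU-sym mgu) y-bound z∈Aθ)

  one-variable-mgu : (A B : Atom) → VariableDisjoint A B → AtMostOneVar A → AtMostOneVar B →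
    Unifiable A B → (θ : Subst) → IsMGU A B θ →
    ((A ∙ θ) ≃ A) ⊎ ((B ∙ θ) ≃ B) ⊎ ((A ∙ θ ≡ B ∙ θ) × Ground (A ∙ θ))
  one-variable-mgu A B disjoint oneA oneB _ θ mgu@(unifies , _)
    with var-or-groundAtom A | var-or-groundAtom B | var-or-groundAtom (A ∙ θ)
  ... | inj₂ groundA | _ | _ = inj₁ (ground⇒∙≃ θ groundA)
  ... | inj₁ _ | inj₂ groundB | _ = inj₂ (inj₁ (ground⇒∙≃ θ groundB))
  ... | inj₁ _ | inj₁ _ | inj₂ groundAθ = inj₂ (inj₂ (unifies , groundAθ))
  ... | inj₁ (x , x∈A) | inj₁ (y , y∈B) | inj₁ (_ , z∈Aθ) =
    map₂ inj₁ (mgu-one-variable-≃ (λ w w∈A → oneA w x w∈A x∈A) (λ w w∈B → oneB w y w∈B y∈B)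
                                  (λ { refl → disjoint x x∈A y∈B }) mgu z∈Aθ)

lemma15 : (S : Signature) → let open FO S in
    (A B : Atom) → VariableDisjoint A B → AtMostOneVar A → AtMostOneVar B →
    Unifiable A B → (θ : Subst) → IsMGU A B θ →
    ((A ∙ θ) ≃ A) ⊎ ((B ∙ θ) ≃ B) ⊎ ((A ∙ θ ≡ B ∙ θ) × Ground (A ∙ θ))
lemma15 = Substitution.one-variable-mgu
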